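{- Let $\widehat{G}$ be a chordal signed separable bigraph. Suppose that a vertex set $S$ minimally separates $\widehat{H_1}$ and $\widehat{H_2}$. Then $\widehat{H_1}$ or $\widehat{H_2}$ contains a signed simplicial edge of $\widehat{G}$.
   Context: A signed graph is a finite simple graph with each edge assigned a sign, positive or negative. A signed bigraph has bipartite underlying graph with bipartition $(X,Y)$; it is separable if its underlying graph contains an induced $2K_2$. A subgraph is a biclique if every vertex of it in $X$ is adjacent to every vertex of it in $Y$; positive if all edges are positive. For an edge $uv$, $N(uv)=(N(u)\cup N(v))\setminus\{u,v\}$; $uv$ is signed simplicial if $N(uv)$ induces a positive biclique. A signed bigraph is chordal if its edges can be ordered $e_1,\dots,e_m$ so that each $e_i$ is signed simplicial in the graph obtained by deleting edges $e_1,\dots,e_{i-1}$ (keeping vertices). A graph is non-trivial if it has an edge. For a vertex set $S$ and non-trivial components $H,H'$ of $\widehat{G}-S$, $S$ minimally separates $H$ and $H'$ if every vertex of $S$ has a neighbour in $H$ and a neighbour in $H'$. -}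

module Defs where

open import Data.Nat using (ℕ)
open import Data.Bool using (Bool; true; false; _∧_; _∨_; if_then_else_)
open import Data.Fin using (Fin; _≟_)
open import Data.Fin.Subset using (Subset; _∈_; _∉_)
open import Data.Product using (Σ; ∃; ∃-syntax; _×_; _,_)
open import Data.Sum using (_⊎_)
open import Relation.Nullary using (¬_; ⌊_⌋)
open import Relation.Binary.PropositionalEquality using (_≡_; _≢_)

data Label : Set where
  none pos neg : Label

-- A signed bigraph on vertex set Fin n: `side v` is the side of the
-- bipartition (X = false, Y = true); `lab u v` is the label of the pair uv.
record SignedBigraph : Set where
  field
    n       : ℕ
    side    : Fin n → Bool
    lab     : Fin n → Fin n → Label
    lab-sym : ∀ u v → lab u v ≡ lab v u
    lab-irr : ∀ v → lab v v ≡ none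
    bip     : ∀ u v → side u ≡ side v → lab u v ≡ none

module _ {n : ℕ} where

  Adj : (Fin n → Fin n → Label) → Fin n → Fin n → Set
  Adj lab u v = lab u v ≢ none

  InN : (Fin n → Fin n → Label) → Fin n → Fin n → Fin n → Set
  InN lab u v x = (Adj lab u x ⊎ Adj lab v x) × x ≢ u × x ≢ v

  SignedSimplicial : (Fin n → Bool) → (Fin n → Fin n → Label) → Fin n → Fin n → Set
  SignedSimplicial side lab u v =
    Adj lab u v ×
    (∀ x y → InN lab u v x → InN lab u v y → side x ≢ side y → lab x y ≡ pos)

  deleteEdge : (Fin n → Fin n → Label) → Fin n → Fin n → Fin n → Fin n → Label
  deleteEdge lab u v x y =
    if (⌊ x ≟ u ⌋ ∧ ⌊ y ≟ v ⌋) ∨ (⌊ x ≟ v ⌋ ∧ ⌊ y ≟ u ⌋) then none else lab x y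

  -- Chordal: the edges can be ordered e1,...,em such that each e_i is signed
  -- simplicial in the graph with e1,...,e_{i-1} deleted (stated recursively:
  -- pick e1 simplicial, delete it, continue until no edges remain).
  data ChordalLab (side : Fin n → Bool) : (Fin n → Fin n → Label) → Set where
    done : ∀ {lab} → (∀ x y → lab x y ≡ none) → ChordalLab side lab
    step : ∀ {lab} u v → SignedSimplicial side lab u v →
           ChordalLab side (deleteEdge lab u v) → ChordalLab side lab

  data Reach (lab : Fin n → Fin n → Label) (S : Subset n) : Fin n → Fin n → Set where
    here  : ∀ {u} → u ∉ S → Reach lab S u u
    there : ∀ {u w x} → Reach lab S u w → Adj lab w x → x ∉ S → Reach lab S u x

module _ (G : SignedBigraph) where
  open SignedBigraph G

  Chordal : Set
  Chordal = ChordalLab side lab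

  -- contains an induced 2K2 (distinctness of the four vertices follows)
  Separable : Set
  Separable = ∃[ a ] ∃[ b ] ∃[ c ] ∃[ d ]
    (Adj lab a b × Adj lab c d ×
     ¬ Adj lab a c × ¬ Adj lab a d × ¬ Adj lab b c × ¬ Adj lab b d)

  SimplicialEdge : Fin n → Fin n → Set
  SimplicialEdge = SignedSimplicial side lab

  Component : Subset n → Subset n → Set
  Component S C =
    (∀ v → v ∈ C → v ∉ S) ×
    (∃[ v ] v ∈ C) ×
    (∀ u v → u ∈ C → v ∈ C → Reach lab S u v) ×
    (∀ u v → u ∈ C → v ∉ S → Adj lab u v → v ∈ C)

  NonTrivial : Subset n → Set
  NonTrivial C = ∃[ u ] ∃[ v ] (u ∈ C × v ∈ C × Adj lab u v)

  MinSeparates : Subset n → Subset n → Subset n → Set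
  MinSeparates S H H' =
    ∀ s → s ∈ S → (∃[ h ] (h ∈ H × Adj lab s h)) × (∃[ h ] (h ∈ H' × Adj lab s h))

  ContainsSimplicialEdge : Subset n → Set
  ContainsSimplicialEdge H = ∃[ u ] ∃[ v ] (u ∈ H × v ∈ H × SimplicialEdge u v)

-- Induct along the chordal elimination ordering. If the first signed
-- simplicial edge uv has an endpoint h in H₁ (or H₂), its other endpoint s
-- cannot lie in S: otherwise a neighbour b of h in H₁ and a neighbour a of s
-- in H₂ are both in N(hs) on opposite sides, so the positive biclique N(hs)
-- would contain the edge ab joining H₁ to H₂ in G − S. So uv lies inside
-- H₁ (or H₂). Otherwise uv avoids H₁ ∪ H₂: deleting it keeps everything the
-- argument needs about H₁, H₂ and S, and a simplicial edge inside H₁ or H₂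
-- of the smaller graph is already simplicial in G. The ordering cannot run
-- out, since H₁ contains an edge.
module Submission where

open import Defs
open import Data.Bool using (Bool; true; false; _∧_; _∨_)
open import Data.Bool.Properties using (∧-comm; ∨-comm; ∧-zeroʳ; ¬-not)
open import Data.Fin using (Fin; _≟_)
open import Data.Fin.Subset using (Subset; _∈_; _∉_)
open import Data.Fin.Subset.Properties using (_∈?_; ⊆-antisym)
open import Data.Nat using (ℕ)
open import Function using (_∘_)
open import Data.Product using (∃-syntax; _×_; _,_; proj₁; proj₂)
open import Data.Sum using (_⊎_; inj₁; inj₂)
import Data.Sum as Sum
open import Relation.Nullary using (yes; no; ⌊_⌋; _⊎-dec_; contradiction)
open import Relation.Binary.PropositionalEquality
  using (_≡_; _≢_; refl; sym; trans; subst)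

module _ {n : ℕ} where

  Labelling : Set
  Labelling = Fin n → Fin n → Label

  ∉-≢ : ∀ {H : Subset n} {u x} → u ∉ H → x ∈ H → x ≢ u
  ∉-≢ u∉H x∈H refl = u∉H x∈H

  deleteEdge-≗ˡ : ∀ (lab : Labelling) {u v x} y → x ≢ u → x ≢ v →
                  deleteEdge lab u v x y ≡ lab x y
  deleteEdge-≗ˡ lab {u} {v} {x} y x≢u x≢v with x ≟ u | x ≟ v
  ... | yes x≡u | _       = contradiction x≡u x≢u
  ... | no _    | yes x≡v = contradiction x≡v x≢v
  ... | no _    | no _    = refl

  deleteEdge-≗ʳ : ∀ (lab : Labelling) {u v} x {y} → y ≢ u → y ≢ v →
                  deleteEdge lab u v x y ≡ lab x y
  deleteEdge-≗ʳ lab {u} {v} x {y} y≢u y≢v with y ≟ u | y ≟ v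
  ... | yes y≡u | _       = contradiction y≡u y≢u
  ... | no _    | yes y≡v = contradiction y≡v y≢v
  ... | no _    | no _
    rewrite ∧-zeroʳ ⌊ x ≟ u ⌋ | ∧-zeroʳ ⌊ x ≟ v ⌋ = refl

  deleteEdge-none-or-same : ∀ (lab : Labelling) u v x y →
    deleteEdge lab u v x y ≡ none ⊎ deleteEdge lab u v x y ≡ lab x y
  deleteEdge-none-or-same lab u v x y
    with (⌊ x ≟ u ⌋ ∧ ⌊ y ≟ v ⌋) ∨ (⌊ x ≟ v ⌋ ∧ ⌊ y ≟ u ⌋)
  ... | true  = inj₁ refl
  ... | false = inj₂ refl

  Adj-deleteEdge⁻ : ∀ (lab : Labelling) {u v x y} →
                    Adj (deleteEdge lab u v) x y → Adj lab x y
  Adj-deleteEdge⁻ lab {u} {v} {x} {y} adj xy≡none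
    with deleteEdge-none-or-same lab u v x y
  ... | inj₁ deleted = adj deleted
  ... | inj₂ same    = adj (trans same xy≡none)

  pos-deleteEdge⁻ : ∀ (lab : Labelling) {u v x y} →
                    deleteEdge lab u v x y ≡ pos → lab x y ≡ pos
  pos-deleteEdge⁻ lab {u} {v} {x} {y} xy≡pos
    with deleteEdge-none-or-same lab u v x y
  ... | inj₁ deleted = contradiction (trans (sym xy≡pos) deleted) λ ()
  ... | inj₂ same    = trans (sym same) xy≡pos

  Adj-deleteEdge⁺ˡ : ∀ (lab : Labelling) {u v x y} → x ≢ u → x ≢ v →
                     Adj lab x y → Adj (deleteEdge lab u v) x y
  Adj-deleteEdge⁺ˡ lab {y = y} x≢u x≢v = subst (_≢ none) (sym (deleteEdge-≗ˡ lab y x≢u x≢v))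

  Adj-deleteEdge⁺ʳ : ∀ (lab : Labelling) {u v x y} → y ≢ u → y ≢ v →
                     Adj lab x y → Adj (deleteEdge lab u v) x y
  Adj-deleteEdge⁺ʳ lab {x = x} y≢u y≢v = subst (_≢ none) (sym (deleteEdge-≗ʳ lab x y≢u y≢v))

  InN-deleteEdge : ∀ (lab : Labelling) {u v p q x} →
                   p ≢ u → p ≢ v → q ≢ u → q ≢ v →
                   InN lab p q x → InN (deleteEdge lab u v) p q x
  InN-deleteEdge lab p≢u p≢v _ _ (inj₁ px , x≢p , x≢q) =
    inj₁ (Adj-deleteEdge⁺ˡ lab p≢u p≢v px) , x≢p , x≢q
  InN-deleteEdge lab _ _ q≢u q≢v (inj₂ qx , x≢p , x≢q) =
    inj₂ (Adj-deleteEdge⁺ˡ lab q≢u q≢v qx) , x≢p , x≢q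

  simplicial-deleteEdge⁻ : ∀ side (lab : Labelling) {u v p q} →
    p ≢ u → p ≢ v → q ≢ u → q ≢ v →
    SignedSimplicial side (deleteEdge lab u v) p q → SignedSimplicial side lab p q
  simplicial-deleteEdge⁻ side lab p≢u p≢v q≢u q≢v (pq , positive) =
    Adj-deleteEdge⁻ lab pq ,
    λ x y x∈N y∈N sides → pos-deleteEdge⁻ lab
      (positive x y (InN-deleteEdge lab p≢u p≢v q≢u q≢v x∈N)
                    (InN-deleteEdge lab p≢u p≢v q≢u q≢v y∈N) sides)

  record IsSignedBigraph (side : Fin n → Bool) (lab : Labelling) : Set where
    field
      symmetric : ∀ x y → lab x y ≡ lab y x
      bipartite : ∀ x y → side x ≡ side y → lab x y ≡ none

    Adj-sym : ∀ {x y} → Adj lab x y → Adj lab y x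
    Adj-sym {x} {y} xy yx≡none = xy (trans (symmetric x y) yx≡none)

    Adj-side : ∀ {x y} → Adj lab x y → side x ≢ side y
    Adj-side {x} {y} xy sides = xy (bipartite x y sides)

    Adj-irrefl : ∀ {x y} → Adj lab x y → x ≢ y
    Adj-irrefl xy refl = Adj-side xy refl

    simplicial-flip : ∀ {u v} → SignedSimplicial side lab u v → SignedSimplicial side lab v u
    simplicial-flip (uv , positive) =
      Adj-sym uv , λ x y x∈N y∈N → positive x y (flipN x∈N) (flipN y∈N)
      where
      flipN : ∀ {x u v} → InN lab v u x → InN lab u v x
      flipN (adj , x≢v , x≢u) = Sum.swap adj , x≢u , x≢v

  deleteEdge-isSignedBigraph : ∀ {side lab} u v → IsSignedBigraph side lab →
                               IsSignedBigraph side (deleteEdge lab u v)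
  deleteEdge-isSignedBigraph {side} {lab} u v G = record
    { symmetric = symmetric′ ; bipartite = bipartite′ }
    where
    open IsSignedBigraph G

    symmetric′ : ∀ x y → deleteEdge lab u v x y ≡ deleteEdge lab u v y x
    symmetric′ x y
      rewrite ∧-comm ⌊ y ≟ u ⌋ ⌊ x ≟ v ⌋ | ∧-comm ⌊ y ≟ v ⌋ ⌊ x ≟ u ⌋
            | ∨-comm (⌊ x ≟ v ⌋ ∧ ⌊ y ≟ u ⌋) (⌊ x ≟ u ⌋ ∧ ⌊ y ≟ v ⌋)
            | symmetric y x = refl

    bipartite′ : ∀ x y → side x ≡ side y → deleteEdge lab u v x y ≡ none
    bipartite′ x y sides with deleteEdge-none-or-same lab u v x y
    ... | inj₁ deleted = deleted
    ... | inj₂ same    = trans same (bipartite x y sides)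

  reach-closed : ∀ {lab : Labelling} {S C : Subset n} →
    (∀ u v → u ∈ C → v ∉ S → Adj lab u v → v ∈ C) →
    ∀ {u x} → Reach lab S u x → u ∈ C → x ∈ C
  reach-closed closed (here _)           u∈C = u∈C
  reach-closed closed (there path wx x∉S) u∈C = closed _ _ (reach-closed closed path u∈C) x∉S wx

module _ {n : ℕ} (S : Subset n) where

  -- H is a nonempty union of non-trivial components of G − S.
  record Region (lab : Labelling) (H : Subset n) : Set where
    field
      avoids    : ∀ {v} → v ∈ H → v ∉ S
      closed    : ∀ {u v} → u ∈ H → v ∉ S → Adj lab u v → v ∈ H
      neighbour : ∀ {h} → h ∈ H → ∃[ b ] (b ∈ H × Adj lab h b)
      inhabited : ∃[ h ] h ∈ H

  record Separation (lab : Labelling) (H₁ H₂ : Subset n) : Set where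
    field
      region₁   : Region lab H₁
      region₂   : Region lab H₂
      disjoint  : ∀ {v} → v ∈ H₁ → v ∉ H₂
      attached₁ : ∀ {s} → s ∈ S → ∃[ h ] (h ∈ H₁ × Adj lab s h)
      attached₂ : ∀ {s} → s ∈ S → ∃[ h ] (h ∈ H₂ × Adj lab s h)

  Separation-swap : ∀ {lab H₁ H₂} → Separation lab H₁ H₂ → Separation lab H₂ H₁
  Separation-swap sep = record
    { region₁ = region₂ ; region₂ = region₁
    ; disjoint = λ v∈H₂ v∈H₁ → disjoint v∈H₁ v∈H₂
    ; attached₁ = attached₂ ; attached₂ = attached₁ }
    where open Separation sep

  region-deleteEdge : ∀ {lab H u v} → u ∉ H → v ∉ H →
                      Region lab H → Region (deleteEdge lab u v) H
  region-deleteEdge {lab} u∉H v∉H R = record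
    { avoids = avoids
    ; closed = λ u∈H v∉S uv → closed u∈H v∉S (Adj-deleteEdge⁻ lab uv)
    ; neighbour = λ h∈H →
        let b , b∈H , hb = neighbour h∈H
        in b , b∈H , Adj-deleteEdge⁺ˡ lab (∉-≢ u∉H h∈H) (∉-≢ v∉H h∈H) hb
    ; inhabited = inhabited }
    where open Region R

  separation-deleteEdge : ∀ {lab H₁ H₂ u v} →
    u ∉ H₁ → v ∉ H₁ → u ∉ H₂ → v ∉ H₂ →
    Separation lab H₁ H₂ → Separation (deleteEdge lab u v) H₁ H₂
  separation-deleteEdge {lab} u∉H₁ v∉H₁ u∉H₂ v∉H₂ sep = record
    { region₁ = region-deleteEdge u∉H₁ v∉H₁ region₁
    ; region₂ = region-deleteEdge u∉H₂ v∉H₂ region₂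
    ; disjoint = disjoint
    ; attached₁ = attached u∉H₁ v∉H₁ attached₁
    ; attached₂ = attached u∉H₂ v∉H₂ attached₂ }
    where
    open Separation sep
    attached : ∀ {H u v} → u ∉ H → v ∉ H →
               (∀ {s} → s ∈ S → ∃[ h ] (h ∈ H × Adj lab s h)) →
               ∀ {s} → s ∈ S → ∃[ h ] (h ∈ H × Adj (deleteEdge lab u v) s h)
    attached u∉H v∉H att s∈S =
      let h , h∈H , sh = att s∈S
      in h , h∈H , Adj-deleteEdge⁺ʳ lab (∉-≢ u∉H h∈H) (∉-≢ v∉H h∈H) sh

module _ {n : ℕ} (side : Fin n → Bool) (S : Subset n) where

  ContainsSimplicial : Labelling → Subset n → Set
  ContainsSimplicial lab H =
    ∃[ u ] ∃[ v ] (u ∈ H × v ∈ H × SignedSimplicial side lab u v)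

  simplicial-endpoint-∉S : ∀ {lab H₁ H₂ h s} →
    IsSignedBigraph side lab → Separation S lab H₁ H₂ →
    SignedSimplicial side lab h s → h ∈ H₁ → s ∉ S
  simplicial-endpoint-∉S {lab} {H₂ = H₂} {h} {s} G sep (hs , positive) h∈H₁ s∈S
    with Region.neighbour (Separation.region₁ sep) h∈H₁ | Separation.attached₂ sep s∈S
  ... | b , b∈H₁ , hb | a , a∈H₂ , sa = disjoint b∈H₁ b∈H₂
    where
    open IsSignedBigraph G
    open Separation sep
    open Region

    a∈N : InN lab h s a
    a∈N = inj₂ sa , (λ { refl → disjoint h∈H₁ a∈H₂ }) , (λ { refl → avoids region₂ a∈H₂ s∈S })

    b∈N : InN lab h s b
    b∈N = inj₁ hb , (λ b≡h → Adj-irrefl hb (sym b≡h)) , (λ { refl → avoids region₁ b∈H₁ s∈S })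

    -- a and h are both opposite to s, and b is opposite to h.
    a-b-sides : side a ≢ side b
    a-b-sides a≡b = Adj-side hb
      (trans (¬-not (Adj-side hs)) (trans (sym (¬-not (Adj-side (Adj-sym sa)))) a≡b))

    ab : Adj lab a b
    ab ab≡none with trans (sym (positive a b a∈N b∈N a-b-sides)) ab≡none
    ... | ()

    b∈H₂ : b ∈ H₂
    b∈H₂ = closed region₂ a∈H₂ (avoids region₁ b∈H₁) ab

  simplicial-touching-region : ∀ {lab H₁ H₂ u v} →
    IsSignedBigraph side lab → Separation S lab H₁ H₂ →
    SignedSimplicial side lab u v → u ∈ H₁ ⊎ v ∈ H₁ → ContainsSimplicial lab H₁
  simplicial-touching-region {H₁ = H₁} {v = v} G sep simp (inj₁ u∈H₁) =
    _ , _ , u∈H₁ , v∈H₁ , simp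
    where
    v∈H₁ : v ∈ H₁
    v∈H₁ = Region.closed (Separation.region₁ sep) u∈H₁
             (simplicial-endpoint-∉S G sep simp u∈H₁) (proj₁ simp)
  simplicial-touching-region G sep simp (inj₂ v∈H₁) =
    simplicial-touching-region G sep (IsSignedBigraph.simplicial-flip G simp) (inj₁ v∈H₁)

  contains-deleteEdge⁻ : ∀ {lab H u v} → u ∉ H → v ∉ H →
    ContainsSimplicial (deleteEdge lab u v) H → ContainsSimplicial lab H
  contains-deleteEdge⁻ {lab} u∉H v∉H (p , q , p∈H , q∈H , simp) =
    p , q , p∈H , q∈H ,
    simplicial-deleteEdge⁻ side lab (∉-≢ u∉H p∈H) (∉-≢ v∉H p∈H)
                                    (∉-≢ u∉H q∈H) (∉-≢ v∉H q∈H) simp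

  separated-contains-simplicial : ∀ {lab H₁ H₂} →
    ChordalLab side lab → IsSignedBigraph side lab → Separation S lab H₁ H₂ →
    ContainsSimplicial lab H₁ ⊎ ContainsSimplicial lab H₂
  separated-contains-simplicial (done noEdges) G sep
    with Region.inhabited (Separation.region₁ sep)
  ... | h , h∈H₁ with Region.neighbour (Separation.region₁ sep) h∈H₁
  ...   | b , _ , hb = contradiction (noEdges h b) hb
  separated-contains-simplicial {H₁ = H₁} {H₂} (step u v simp rest) G sep
    with (u ∈? H₁) ⊎-dec (v ∈? H₁) | (u ∈? H₂) ⊎-dec (v ∈? H₂)
  ... | yes touches₁ | _ = inj₁ (simplicial-touching-region G sep simp touches₁)
  ... | no _ | yes touches₂ =
    inj₂ (simplicial-touching-region G (Separation-swap S sep) simp touches₂)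
  ... | no avoids₁ | no avoids₂ =
    Sum.map (contains-deleteEdge⁻ u∉H₁ v∉H₁) (contains-deleteEdge⁻ u∉H₂ v∉H₂)
      (separated-contains-simplicial rest (deleteEdge-isSignedBigraph u v G)
         (separation-deleteEdge S u∉H₁ v∉H₁ u∉H₂ v∉H₂ sep))
    where
    u∉H₁ : u ∉ H₁
    u∉H₁ = avoids₁ ∘ inj₁
    v∉H₁ : v ∉ H₁
    v∉H₁ = avoids₁ ∘ inj₂
    u∉H₂ : u ∉ H₂
    u∉H₂ = avoids₂ ∘ inj₁
    v∉H₂ : v ∉ H₂
    v∉H₂ = avoids₂ ∘ inj₂

module _ (G : SignedBigraph) where
  open SignedBigraph G

  isSignedBigraph : IsSignedBigraph side lab
  isSignedBigraph = record { symmetric = lab-sym ; bipartite = bip }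

  component-unique : ∀ {S C D v} → Component G S C → Component G S D →
                     v ∈ C → v ∈ D → C ≡ D
  component-unique (_ , _ , connectedC , closedC) (_ , _ , connectedD , closedD) v∈C v∈D =
    ⊆-antisym (λ x∈C → reach-closed closedD (connectedC _ _ v∈C x∈C) v∈D)
              (λ x∈D → reach-closed closedC (connectedD _ _ v∈D x∈D) v∈C)

  component-region : ∀ {S C} → Component G S C → NonTrivial G C → Region S lab C
  component-region {C = C} (avoids , inhabited , connected , closed) (p , q , p∈C , q∈C , pq) =
    record
      { avoids = λ {v} → avoids v
      ; closed = closed _ _
      ; neighbour = neighbour
      ; inhabited = inhabited }
    where
    -- Walking from p to h, the last step enters h from a vertex of C.
    neighbour : ∀ {h} → h ∈ C → ∃[ b ] (b ∈ C × Adj lab h b)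
    neighbour {h} h∈C with h ≟ p | connected p h p∈C h∈C
    ... | yes refl | _ = q , q∈C , pq
    ... | no h≢p | here _ = contradiction refl h≢p
    ... | no _   | there path wh _ =
      _ , reach-closed closed path p∈C , IsSignedBigraph.Adj-sym isSignedBigraph wh

lemma4p3 : (G : SignedBigraph) → Chordal G → Separable G →
    (S H₁ H₂ : Subset (SignedBigraph.n G)) →
    Component G S H₁ → NonTrivial G H₁ →
    Component G S H₂ → NonTrivial G H₂ →
    H₁ ≢ H₂ →
    MinSeparates G S H₁ H₂ →
    ContainsSimplicialEdge G H₁ ⊎ ContainsSimplicialEdge G H₂
lemma4p3 G chordal _ S H₁ H₂ comp₁ nontrivial₁ comp₂ nontrivial₂ H₁≢H₂ minSeparates =
  separated-contains-simplicial (SignedBigraph.side G) S chordal (isSignedBigraph G) record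
    { region₁ = component-region G comp₁ nontrivial₁
    ; region₂ = component-region G comp₂ nontrivial₂
    ; disjoint = λ v∈H₁ v∈H₂ → H₁≢H₂ (component-unique G comp₁ comp₂ v∈H₁ v∈H₂)
    ; attached₁ = λ s∈S → proj₁ (minSeparates _ s∈S)
    ; attached₂ = λ s∈S → proj₂ (minSeparates _ s∈S) }
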